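{- For every integer $n\geq 1$, define \[ \xi(n)=\sum_{k=0}^{n}\binom{n}{k}\left(\frac{k}{n}\right)^k\left(1-\frac{k}{n}\right)^{n-k}, \qquad \xi_2(n)=\sum_{k=0}^{n}\sum_{j=0}^{n-k}\binom{n}{k}\binom{n-k}{j}\left(\frac{k}{n}\right)^k\left(\frac{j}{n}\right)^j\left(1-\frac{k}{n}-\frac{j}{n}\right)^{n-k-j}. \] Then $\xi_2(n)=\xi(n)+n$ for every integer $n\geq 1$.
   Context: The convention $0^0=1$ is used in the sums defining $\xi(n)$ and $\xi_2(n)$. -}

module Defs where

open import Data.Nat as ℕ using (ℕ; zero; suc; _∸_)
open import Data.Nat.Combinatorics using (_C_)
open import Data.Integer using (+_)
open import Data.Rational using (ℚ; 0ℚ; 1ℚ; _+_; _*_; _-_; _/_)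

-- power of a rational with natural exponent; q ^ 0 = 1 (so 0^0 = 1)
_^_ : ℚ → ℕ → ℚ
q ^ zero  = 1ℚ
q ^ suc m = q * (q ^ m)

sumTo : ℕ → (ℕ → ℚ) → ℚ
sumTo zero    f = f 0
sumTo (suc n) f = sumTo n f + f (suc n)

ι : ℕ → ℚ
ι m = (+ m) / 1

ξ : (n : ℕ) → .{{_ : ℕ.NonZero n}} → ℚ
ξ n = sumTo n λ k →
  ι (n C k) * (((+ k) / n) ^ k) * ((1ℚ - (+ k) / n) ^ (n ∸ k))

ξ₂ : (n : ℕ) → .{{_ : ℕ.NonZero n}} → ℚ
ξ₂ n = sumTo n λ k → sumTo (n ∸ k) λ j →
  ι (n C k) * ι ((n ∸ k) C j) * (((+ k) / n) ^ k) * (((+ j) / n) ^ j)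
    * ((1ℚ - (+ k) / n - (+ j) / n) ^ (n ∸ k ∸ j))

-- Write N^(m) for the falling factorial N P′ m. For any w and s, expanding (s - k w)^(N-k) binomially and
-- regrouping along the diagonals k + j = m turns  Σ_k C(N,k) (k w)^k (s - k w)^(N-k)  into
-- Σ_m C(N,m) w^m s^(N-m) Δ^m[x^m](0); the m-th forward difference of x^m is m!, so this is the Abel-type
-- sum  Σ_m N^(m) w^m s^(N-m).  With w = 1/n and s = 1 it gives ξ(n) = Σ_t n^(t) w^t.  Applying it to the
-- inner sum of ξ₂(n), exchanging the two summations and applying it once more gives
-- ξ₂(n) = Σ_t (t+1) n^(t) w^t.  Finally (n - t) n^(t) = n^(t+1) and n w = 1 make  t v_t = n (v_t - v_(t+1))
-- for v_t = n^(t) w^t, so Σ_t t v_t telescopes to n v_0 = n.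

module Submission where

open import Defs
open import Data.Nat as ℕ using (ℕ; zero; suc; NonZero; _∸_; _≤_; _<_; z≤n; s≤s; _!)
import Data.Nat.Properties as ℕP
open import Data.Nat.Combinatorics
  using (_C_; nCn≡1; nC1≡n; nCk≡nC[n∸k]; k>n⇒nCk≡0; nCk+nC[k+1]≡[n+1]C[k+1])
open import Data.Nat.Combinatorics.Base using (_P′_)
open import Data.Integer as ℤ using (+_)
import Data.Integer.Properties as ℤP
import Data.Integer.Solver as ℤSolver
import Data.Rational as ℚ
import Data.Rational.Properties as ℚP
import Data.Rational.Unnormalised as ℚᵘ
import Data.Rational.Unnormalised.Properties as ℚᵘP
open import Data.Rational.Solver using (module +-*-Solver)
open import Relation.Binary.PropositionalEquality using (_≡_; refl; sym; trans; cong; cong₂; module ≡-Reasoning)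

module BinomialIdentities where

  open import Algebra.Properties.CommutativeSemigroup ℕP.*-commutativeSemigroup
    using (x∙yz≈y∙xz; xy∙z≈xz∙y; interchange)
  open import Data.Nat using (_+_; _*_)
  open import Data.Nat.Combinatorics using (nCk≡n!/k![n-k]!; k![n∸k]!∣n!)
  open import Data.Nat.Combinatorics.Specification using (nP′k≡n!/[n∸k]!)
  open import Data.Nat.Divisibility using (m≤n⇒m!∣n!)
  open import Data.Nat.DivMod using (_/_; m/n*n≡m)
  open ℕP
  open ≡-Reasoning

  nCk*k!*[n∸k]!≡n! : ∀ {n k} → k ≤ n → (n C k) * k ! * (n ∸ k) ! ≡ n !
  nCk*k!*[n∸k]!≡n! {n} {k} k≤n = begin
    (n C k) * k ! * (n ∸ k) !                   ≡⟨ *-assoc (n C k) (k !) ((n ∸ k) !) ⟩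
    (n C k) * (k ! * (n ∸ k) !)                 ≡⟨ cong (_* (k ! * (n ∸ k) !)) (nCk≡n!/k![n-k]! k≤n) ⟩
    n ! / (k ! * (n ∸ k) !) * (k ! * (n ∸ k) !) ≡⟨ m/n*n≡m (k![n∸k]!∣n! k≤n) ⟩
    n !                                         ∎
    where instance _ = k !* (n ∸ k) !≢0

  nP′k*[n∸k]!≡n! : ∀ {n k} → k ≤ n → (n P′ k) * (n ∸ k) ! ≡ n !
  nP′k*[n∸k]!≡n! {n} {k} k≤n =
    trans (cong (_* (n ∸ k) !) (nP′k≡n!/[n∸k]! k≤n)) (m/n*n≡m (m≤n⇒m!∣n! (m∸n≤m n k)))
    where instance _ = (n ∸ k) !≢0

  nCk*k!≡nP′k : ∀ {n k} → k ≤ n → (n C k) * k ! ≡ n P′ k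
  nCk*k!≡nP′k {n} {k} k≤n = *-cancelʳ-≡ _ _ ((n ∸ k) !) {{(n ∸ k) !≢0}}
    (trans (nCk*k!*[n∸k]!≡n! k≤n) (sym (nP′k*[n∸k]!≡n! k≤n)))

  nP′[m+r]≡nP′m*[n∸m]P′r : ∀ n m r → n P′ (m + r) ≡ (n P′ m) * ((n ∸ m) P′ r)
  nP′[m+r]≡nP′m*[n∸m]P′r n m zero    = trans (cong (n P′_) (+-identityʳ m)) (sym (*-identityʳ (n P′ m)))
  nP′[m+r]≡nP′m*[n∸m]P′r n m (suc r) = begin
    n P′ (m + suc r)                            ≡⟨ cong (n P′_) (+-suc m r) ⟩
    (n ∸ (m + r)) * (n P′ (m + r))
      ≡⟨ cong₂ _*_ (sym (∸-+-assoc n m r)) (nP′[m+r]≡nP′m*[n∸m]P′r n m r) ⟩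
    (n ∸ m ∸ r) * ((n P′ m) * ((n ∸ m) P′ r))   ≡⟨ x∙yz≈y∙xz (n ∸ m ∸ r) (n P′ m) ((n ∸ m) P′ r) ⟩
    (n P′ m) * ((n ∸ m) P′ suc r)               ∎

  nCk*[n∸k]P′m≡nP′m*[n∸m]Ck : ∀ {n k m} → k + m ≤ n →
                              (n C k) * ((n ∸ k) P′ m) ≡ (n P′ m) * ((n ∸ m) C k)
  nCk*[n∸k]P′m≡nP′m*[n∸m]Ck {n} {k} {m} k+m≤n = *-cancelʳ-≡ _ _ (k !) {{k !≢0}} (begin
    (n C k) * ((n ∸ k) P′ m) * k !     ≡⟨ xy∙z≈xz∙y (n C k) ((n ∸ k) P′ m) (k !) ⟩
    (n C k) * k ! * ((n ∸ k) P′ m)     ≡⟨ cong (_* ((n ∸ k) P′ m)) (nCk*k!≡nP′k k≤n) ⟩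
    (n P′ k) * ((n ∸ k) P′ m)          ≡⟨ sym (nP′[m+r]≡nP′m*[n∸m]P′r n k m) ⟩
    n P′ (k + m)                       ≡⟨ cong (n P′_) (+-comm k m) ⟩
    n P′ (m + k)                       ≡⟨ nP′[m+r]≡nP′m*[n∸m]P′r n m k ⟩
    (n P′ m) * ((n ∸ m) P′ k)          ≡⟨ cong ((n P′ m) *_) (sym (nCk*k!≡nP′k k≤n∸m)) ⟩
    (n P′ m) * (((n ∸ m) C k) * k !)   ≡⟨ sym (*-assoc (n P′ m) ((n ∸ m) C k) (k !)) ⟩
    (n P′ m) * ((n ∸ m) C k) * k !     ∎)
    where
    k≤n = ≤-trans (m≤m+n k m) k+m≤n
    k≤n∸m = m+n≤o⇒m≤o∸n k k+m≤n

  nCk*[n∸k]C[m∸k]≡nCm*mCk : ∀ {n m k} → k ≤ m → m ≤ n →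
                            (n C k) * ((n ∸ k) C (m ∸ k)) ≡ (n C m) * (m C k)
  nCk*[n∸k]C[m∸k]≡nCm*mCk {n} {m} {k} k≤m m≤n =
    *-cancelʳ-≡ _ _ (k ! * (m ∸ k) !) {{k !* (m ∸ k) !≢0}} (begin
      (n C k) * ((n ∸ k) C (m ∸ k)) * (k ! * (m ∸ k) !)
        ≡⟨ interchange (n C k) ((n ∸ k) C (m ∸ k)) (k !) ((m ∸ k) !) ⟩
      (n C k) * k ! * (((n ∸ k) C (m ∸ k)) * (m ∸ k) !)
        ≡⟨ cong₂ _*_ (nCk*k!≡nP′k k≤n) (nCk*k!≡nP′k (∸-monoˡ-≤ k m≤n)) ⟩
      (n P′ k) * ((n ∸ k) P′ (m ∸ k))        ≡⟨ sym (nP′[m+r]≡nP′m*[n∸m]P′r n k (m ∸ k)) ⟩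
      n P′ (k + (m ∸ k))                     ≡⟨ cong (n P′_) (m+[n∸m]≡n k≤m) ⟩
      n P′ m                                 ≡⟨ sym (nCk*k!≡nP′k m≤n) ⟩
      (n C m) * m !                          ≡⟨ cong ((n C m) *_) (sym (nCk*k!*[n∸k]!≡n! k≤m)) ⟩
      (n C m) * ((m C k) * k ! * (m ∸ k) !)  ≡⟨ cong ((n C m) *_) (*-assoc (m C k) (k !) ((m ∸ k) !)) ⟩
      (n C m) * ((m C k) * (k ! * (m ∸ k) !)) ≡⟨ sym (*-assoc (n C m) (m C k) (k ! * (m ∸ k) !)) ⟩
      (n C m) * (m C k) * (k ! * (m ∸ k) !)  ∎)
    where
    k≤n = ≤-trans k≤m m≤n

open BinomialIdentities
open ℚ using (ℚ; 0ℚ; 1ℚ; _+_; _*_; _-_; -_; _/_; toℚᵘ)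
open ℚP using (toℚᵘ-injective; toℚᵘ-fromℚᵘ; toℚᵘ-homo-+; toℚᵘ-homo-*; +-comm; +-assoc; +-identityˡ;
               +-identityʳ; +-inverseʳ; *-assoc; *-identityˡ; *-identityʳ; *-zeroˡ; *-zeroʳ; *-distribˡ-+;
               *-distribʳ-+)

toℚᵘ-i/suc[d] : ∀ i d → toℚᵘ (i / suc d) ℚᵘ.≃ ℚᵘ.mkℚᵘ i d
toℚᵘ-i/suc[d] i d = toℚᵘ-fromℚᵘ (ℚᵘ.mkℚᵘ i d)

ι-suc : ∀ a → ι (suc a) ≡ 1ℚ + ι a
ι-suc a = toℚᵘ-injective (begin
  toℚᵘ (ι (suc a))                          ≈⟨ toℚᵘ-i/suc[d] (+ suc a) 0 ⟩
  ℚᵘ.mkℚᵘ (+ suc a) 0                       ≈⟨ ℚᵘ.*≡* eq ⟩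
  ℚᵘ.mkℚᵘ (+ 1) 0 ℚᵘ.+ ℚᵘ.mkℚᵘ (+ a) 0
    ≈⟨ ℚᵘP.+-cong (toℚᵘ-i/suc[d] (+ 1) 0) (toℚᵘ-i/suc[d] (+ a) 0) ⟨
  toℚᵘ 1ℚ ℚᵘ.+ toℚᵘ (ι a)                   ≈⟨ toℚᵘ-homo-+ 1ℚ (ι a) ⟨
  toℚᵘ (1ℚ + ι a)                           ∎)
  where
  open ℚᵘP.≃-Reasoning
  open ℤSolver.+-*-Solver
  eq : + suc a ℤ.* (+ 1 ℤ.* + 1) ≡ (+ 1 ℤ.* + 1 ℤ.+ + a ℤ.* + 1) ℤ.* + 1
  eq = solve 1 (λ A → (con (+ 1) :+ A) :* (con (+ 1) :* con (+ 1))
                    := (con (+ 1) :* con (+ 1) :+ A :* con (+ 1)) :* con (+ 1)) refl (+ a)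

k/n≡ι[k]*1/n : ∀ k n .{{_ : NonZero n}} → (+ k) / n ≡ ι k * ((+ 1) / n)
k/n≡ι[k]*1/n k (suc d) = toℚᵘ-injective (begin
  toℚᵘ ((+ k) / suc d)                          ≈⟨ toℚᵘ-i/suc[d] (+ k) d ⟩
  ℚᵘ.mkℚᵘ (+ k) d                               ≈⟨ ℚᵘ.*≡* eq ⟩
  ℚᵘ.mkℚᵘ (+ k) 0 ℚᵘ.* ℚᵘ.mkℚᵘ (+ 1) d
    ≈⟨ ℚᵘP.*-cong (toℚᵘ-i/suc[d] (+ k) 0) (toℚᵘ-i/suc[d] (+ 1) d) ⟨
  toℚᵘ (ι k) ℚᵘ.* toℚᵘ ((+ 1) / suc d)          ≈⟨ toℚᵘ-homo-* (ι k) ((+ 1) / suc d) ⟨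
  toℚᵘ (ι k * ((+ 1) / suc d))                  ∎)
  where
  open ℚᵘP.≃-Reasoning
  open ℤSolver.+-*-Solver
  eq : + k ℤ.* + (suc d ℕ.+ 0) ≡ (+ k ℤ.* + 1) ℤ.* + suc d
  eq = trans (cong (λ m → + k ℤ.* + m) (ℕP.+-identityʳ (suc d)))
             (solve 2 (λ K D → K :* D := (K :* con (+ 1)) :* D) refl (+ k) (+ suc d))

ι[n]*1/n≡1 : ∀ n .{{_ : NonZero n}} → ι n * ((+ 1) / n) ≡ 1ℚ
ι[n]*1/n≡1 n@(suc d) = trans (sym (k/n≡ι[k]*1/n n n))
  (toℚᵘ-injective (ℚᵘP.≃-trans (toℚᵘ-i/suc[d] (+ n) d) (ℚᵘ.*≡* (ℤP.*-comm (+ n) (+ 1)))))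

open ≡-Reasoning
open +-*-Solver

ι-+ : ∀ a b → ι (a ℕ.+ b) ≡ ι a + ι b
ι-+ zero    b = sym (+-identityˡ (ι b))
ι-+ (suc a) b = begin
  ι (suc (a ℕ.+ b))     ≡⟨ ι-suc (a ℕ.+ b) ⟩
  1ℚ + ι (a ℕ.+ b)      ≡⟨ cong (_+_ 1ℚ) (ι-+ a b) ⟩
  1ℚ + (ι a + ι b)      ≡⟨ sym (+-assoc 1ℚ (ι a) (ι b)) ⟩
  1ℚ + ι a + ι b        ≡⟨ cong (_+ ι b) (sym (ι-suc a)) ⟩
  ι (suc a) + ι b       ∎

ι-* : ∀ a b → ι (a ℕ.* b) ≡ ι a * ι b
ι-* zero    b = sym (*-zeroˡ (ι b))
ι-* (suc a) b = begin
  ι (b ℕ.+ a ℕ.* b)     ≡⟨ ι-+ b (a ℕ.* b) ⟩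
  ι b + ι (a ℕ.* b)     ≡⟨ cong (_+_ (ι b)) (ι-* a b) ⟩
  ι b + ι a * ι b       ≡⟨ solve 2 (λ A B → B :+ A :* B := (con 1ℚ :+ A) :* B) refl (ι a) (ι b) ⟩
  (1ℚ + ι a) * ι b      ≡⟨ cong (_* ι b) (sym (ι-suc a)) ⟩
  ι (suc a) * ι b       ∎

ι-∸ : ∀ {a b} → b ≤ a → ι (a ∸ b) ≡ ι a - ι b
ι-∸ {a} {b} b≤a = begin
  ι (a ∸ b)                  ≡⟨ solve 2 (λ X B → X := (X :+ B) :- B) refl (ι (a ∸ b)) (ι b) ⟩
  (ι (a ∸ b) + ι b) - ι b    ≡⟨ cong (_- ι b) (sym (ι-+ (a ∸ b) b)) ⟩
  ι (a ∸ b ℕ.+ b) - ι b      ≡⟨ cong (λ c → ι c - ι b) (ℕP.m∸n+n≡m b≤a) ⟩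
  ι a - ι b                  ∎

^-homo-* : ∀ a p q → a ^ (p ℕ.+ q) ≡ a ^ p * a ^ q
^-homo-* a zero    q = sym (*-identityˡ (a ^ q))
^-homo-* a (suc p) q = trans (cong (a *_) (^-homo-* a p q)) (sym (*-assoc a (a ^ p) (a ^ q)))

^-distrib-* : ∀ a b p → (a * b) ^ p ≡ a ^ p * b ^ p
^-distrib-* a b zero    = refl
^-distrib-* a b (suc p) = trans (cong ((a * b) *_) (^-distrib-* a b p))
  (solve 4 (λ A B X Y → (A :* B) :* (X :* Y) := (A :* X) :* (B :* Y)) refl a b (a ^ p) (b ^ p))

1^p≡1 : ∀ p → 1ℚ ^ p ≡ 1ℚ
1^p≡1 zero    = refl
1^p≡1 (suc p) = trans (*-identityˡ (1ℚ ^ p)) (1^p≡1 p)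

sumTo-cong : ∀ n {f g : ℕ → ℚ} → (∀ k → k ≤ n → f k ≡ g k) → sumTo n f ≡ sumTo n g
sumTo-cong zero    f≗g = f≗g 0 z≤n
sumTo-cong (suc n) f≗g =
  cong₂ _+_ (sumTo-cong n (λ k k≤n → f≗g k (ℕP.m≤n⇒m≤1+n k≤n))) (f≗g (suc n) ℕP.≤-refl)

sumTo-distrib-+ : ∀ n (f g : ℕ → ℚ) → sumTo n (λ k → f k + g k) ≡ sumTo n f + sumTo n g
sumTo-distrib-+ zero    f g = refl
sumTo-distrib-+ (suc n) f g = trans (cong (_+ (f (suc n) + g (suc n))) (sumTo-distrib-+ n f g))
  (solve 4 (λ A B C D → (A :+ B) :+ (C :+ D) := (A :+ C) :+ (B :+ D)) refl
            (sumTo n f) (sumTo n g) (f (suc n)) (g (suc n)))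

*-distribˡ-sumTo : ∀ n c (f : ℕ → ℚ) → c * sumTo n f ≡ sumTo n (λ k → c * f k)
*-distribˡ-sumTo zero    c f = refl
*-distribˡ-sumTo (suc n) c f =
  trans (*-distribˡ-+ c (sumTo n f) (f (suc n))) (cong (_+ c * f (suc n)) (*-distribˡ-sumTo n c f))

sumTo-zero : ∀ n {f : ℕ → ℚ} → (∀ k → k ≤ n → f k ≡ 0ℚ) → sumTo n f ≡ 0ℚ
sumTo-zero zero    f≗0 = f≗0 0 z≤n
sumTo-zero (suc n) f≗0 =
  trans (cong₂ _+_ (sumTo-zero n (λ k k≤n → f≗0 k (ℕP.m≤n⇒m≤1+n k≤n))) (f≗0 (suc n) ℕP.≤-refl))
        (+-identityˡ 0ℚ)

sumTo-suc : ∀ n (f : ℕ → ℚ) → sumTo (suc n) f ≡ f 0 + sumTo n (λ k → f (suc k))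
sumTo-suc zero    f = refl
sumTo-suc (suc n) f = trans (cong (_+ f (suc (suc n))) (sumTo-suc n f)) (+-assoc (f 0) _ _)

sumTo-last : ∀ n (f : ℕ → ℚ) → (∀ k → k < n → f k ≡ 0ℚ) → sumTo n f ≡ f n
sumTo-last zero    f _   = refl
sumTo-last (suc n) f f≗0 =
  trans (cong (_+ f (suc n)) (sumTo-zero n (λ k k≤n → f≗0 k (s≤s k≤n)))) (+-identityˡ (f (suc n)))

sumTo-const : ∀ n c → sumTo n (λ _ → c) ≡ ι (suc n) * c
sumTo-const zero    c = sym (*-identityˡ c)
sumTo-const (suc n) c = begin
  sumTo n (λ _ → c) + c      ≡⟨ cong (_+ c) (sumTo-const n c) ⟩
  ι (suc n) * c + c          ≡⟨ solve 2 (λ N C → N :* C :+ C := (con 1ℚ :+ N) :* C) refl (ι (suc n)) c ⟩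
  (1ℚ + ι (suc n)) * c       ≡⟨ cong (_* c) (sym (ι-suc (suc n))) ⟩
  ι (suc (suc n)) * c        ∎

sumTo-telescope : ∀ n (f : ℕ → ℚ) → sumTo n (λ k → f k - f (suc k)) ≡ f 0 - f (suc n)
sumTo-telescope zero    f = refl
sumTo-telescope (suc n) f = trans (cong (_+ (f (suc n) - f (suc (suc n)))) (sumTo-telescope n f))
  (solve 3 (λ A B C → (A :- B) :+ (B :- C) := A :- C) refl (f 0) (f (suc n)) (f (suc (suc n))))

sumTo-comm : ∀ m n (f : ℕ → ℕ → ℚ) →
             sumTo m (λ i → sumTo n (f i)) ≡ sumTo n (λ j → sumTo m (λ i → f i j))
sumTo-comm zero    n f = refl
sumTo-comm (suc m) n f = trans (cong (_+ sumTo n (f (suc m))) (sumTo-comm m n f))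
  (sym (sumTo-distrib-+ n (λ j → sumTo m (λ i → f i j)) (f (suc m))))

sumTo-reverse : ∀ n (f : ℕ → ℚ) → sumTo n f ≡ sumTo n (λ k → f (n ∸ k))
sumTo-reverse zero    f = refl
sumTo-reverse (suc n) f = begin
  sumTo n f + f (suc n)                         ≡⟨ cong (_+ f (suc n)) (sumTo-reverse n f) ⟩
  sumTo n (λ k → f (n ∸ k)) + f (suc n)         ≡⟨ +-comm (sumTo n (λ k → f (n ∸ k))) (f (suc n)) ⟩
  f (suc n) + sumTo n (λ k → f (n ∸ k))         ≡⟨ sym (sumTo-suc n (λ k → f (suc n ∸ k))) ⟩
  sumTo (suc n) (λ k → f (suc n ∸ k))           ∎

sumTo-triangle : ∀ n (f : ℕ → ℕ → ℚ) →
  sumTo n (λ k → sumTo (n ∸ k) (f k)) ≡ sumTo n (λ m → sumTo m (λ k → f k (m ∸ k)))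
sumTo-triangle zero    f = refl
sumTo-triangle (suc n) f = begin
  sumTo (suc n) (λ k → sumTo (suc n ∸ k) (f k))
    ≡⟨ sumTo-suc n _ ⟩
  sumTo (suc n) (f 0) + sumTo n (λ k → sumTo (n ∸ k) (f (suc k)))
    ≡⟨ cong (_+_ (sumTo (suc n) (f 0))) (sumTo-triangle n (λ k → f (suc k))) ⟩
  sumTo (suc n) (f 0) + sumTo n (λ m → g (suc m))
    ≡⟨ cong (_+_ (sumTo (suc n) (f 0))) (trans (sym (+-identityˡ _)) (sym (sumTo-suc n g))) ⟩
  sumTo (suc n) (f 0) + sumTo (suc n) g
    ≡⟨ sym (sumTo-distrib-+ (suc n) (f 0) g) ⟩
  sumTo (suc n) (λ m → f 0 m + g m)
    ≡⟨ sumTo-cong (suc n) (λ m _ → sym (diagonal m)) ⟩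
  sumTo (suc n) (λ m → sumTo m (λ k → f k (m ∸ k)))  ∎
  where
  g : ℕ → ℚ
  g zero    = 0ℚ
  g (suc m) = sumTo m (λ k → f (suc k) (m ∸ k))
  diagonal : ∀ m → sumTo m (λ k → f k (m ∸ k)) ≡ f 0 m + g m
  diagonal zero    = sym (+-identityʳ (f 0 0))
  diagonal (suc m) = sumTo-suc m _

sumTo-triangle-comm : ∀ n (f : ℕ → ℕ → ℚ) →
  sumTo n (λ k → sumTo (n ∸ k) (f k)) ≡ sumTo n (λ j → sumTo (n ∸ j) (λ k → f k j))
sumTo-triangle-comm n f = begin
  sumTo n (λ k → sumTo (n ∸ k) (f k))                     ≡⟨ sumTo-triangle n f ⟩
  sumTo n (λ m → sumTo m (λ k → f k (m ∸ k)))             ≡⟨ sumTo-cong n (λ m _ → reflect m) ⟩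
  sumTo n (λ m → sumTo m (λ j → f (m ∸ j) j))             ≡⟨ sym (sumTo-triangle n (λ j k → f k j)) ⟩
  sumTo n (λ j → sumTo (n ∸ j) (λ k → f k j))             ∎
  where
  reflect : ∀ m → sumTo m (λ k → f k (m ∸ k)) ≡ sumTo m (λ j → f (m ∸ j) j)
  reflect m = trans (sumTo-reverse m _) (sumTo-cong m (λ j j≤m → cong (f (m ∸ j)) (ℕP.m∸[m∸n]≡n j≤m)))

sumTo-pascal : ∀ n (g : ℕ → ℚ) →
  sumTo (suc n) (λ k → ι (suc n C k) * g k) ≡
  sumTo n (λ k → ι (n C k) * g k) + sumTo n (λ k → ι (n C k) * g (suc k))
sumTo-pascal n g = begin
  sumTo (suc n) (λ k → ι (suc n C k) * g k)
    ≡⟨ sumTo-suc n _ ⟩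
  g₀ + sumTo n (λ k → ι (suc n C suc k) * g (suc k))
    ≡⟨ cong (_+_ g₀) (trans (sumTo-cong n (λ k _ → pascal k)) (sumTo-distrib-+ n f h)) ⟩
  g₀ + (A + B)                        ≡⟨ solve 3 (λ X A B → X :+ (A :+ B) := (X :+ B) :+ A) refl g₀ A B ⟩
  (g₀ + B) + A                        ≡⟨ cong (_+ A) (sym (sumTo-suc n (λ k → ι (n C k) * g k))) ⟩
  P + ι (n C suc n) * g (suc n) + A   ≡⟨ cong (λ c → P + ι c * g (suc n) + A) (k>n⇒nCk≡0 (ℕP.n<1+n n)) ⟩
  P + 0ℚ * g (suc n) + A              ≡⟨ cong (λ z → P + z + A) (*-zeroˡ (g (suc n))) ⟩
  P + 0ℚ + A                          ≡⟨ cong (_+ A) (+-identityʳ P) ⟩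
  P + A                               ∎
  where
  g₀ : ℚ
  g₀ = ι 1 * g 0
  f h : ℕ → ℚ
  f k = ι (n C k) * g (suc k)
  h k = ι (n C suc k) * g (suc k)
  A : ℚ
  A = sumTo n f
  B : ℚ
  B = sumTo n h
  P : ℚ
  P = sumTo n (λ k → ι (n C k) * g k)
  pascal : ∀ k → ι (suc n C suc k) * g (suc k) ≡ f k + h k
  pascal k = begin
    ι (suc n C suc k) * g (suc k)
      ≡⟨ cong (λ c → ι c * g (suc k)) (sym (nCk+nC[k+1]≡[n+1]C[k+1] n k)) ⟩
    ι (n C k ℕ.+ n C suc k) * g (suc k)                   ≡⟨ cong (_* g (suc k)) (ι-+ (n C k) (n C suc k)) ⟩
    (ι (n C k) + ι (n C suc k)) * g (suc k)               ≡⟨ *-distribʳ-+ (g (suc k)) (ι (n C k)) (ι (n C suc k)) ⟩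
    f k + h k                                             ∎

binomial : ∀ x y n → (x + y) ^ n ≡ sumTo n (λ k → ι (n C k) * (x ^ k * y ^ (n ∸ k)))
binomial x y zero    = refl
binomial x y (suc n) = begin
  (x + y) * (x + y) ^ n   ≡⟨ cong ((x + y) *_) (binomial x y n) ⟩
  (x + y) * S             ≡⟨ *-distribʳ-+ S x y ⟩
  x * S + y * S
    ≡⟨ cong₂ _+_ (trans (*-distribˡ-sumTo n x _) (sumTo-cong n (λ k _ → x-term k)))
                 (trans (*-distribˡ-sumTo n y _) (sumTo-cong n y-term)) ⟩
  sumTo n (λ k → ι (n C k) * g (suc k)) + sumTo n (λ k → ι (n C k) * g k)
    ≡⟨ +-comm (sumTo n (λ k → ι (n C k) * g (suc k))) _ ⟩
  sumTo n (λ k → ι (n C k) * g k) + sumTo n (λ k → ι (n C k) * g (suc k))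
    ≡⟨ sumTo-pascal n g ⟨
  sumTo (suc n) (λ k → ι (suc n C k) * g k)  ∎
  where
  S : ℚ
  S = sumTo n (λ k → ι (n C k) * (x ^ k * y ^ (n ∸ k)))
  g : ℕ → ℚ
  g k = x ^ k * y ^ (suc n ∸ k)
  x-term : ∀ k → x * (ι (n C k) * (x ^ k * y ^ (n ∸ k))) ≡ ι (n C k) * g (suc k)
  x-term k = solve 4 (λ X C P Q → X :* (C :* (P :* Q)) := C :* ((X :* P) :* Q)) refl
                     x (ι (n C k)) (x ^ k) (y ^ (n ∸ k))
  y-term : ∀ k → k ≤ n → y * (ι (n C k) * (x ^ k * y ^ (n ∸ k))) ≡ ι (n C k) * g k
  y-term k k≤n = trans (solve 4 (λ Y C P Q → Y :* (C :* (P :* Q)) := C :* (P :* (Y :* Q))) refl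
                                 y (ι (n C k)) (x ^ k) (y ^ (n ∸ k)))
                       (cong (λ e → ι (n C k) * (x ^ k * y ^ e)) (sym (ℕP.+-∸-assoc 1 k≤n)))

[x+1]^n-binomial : ∀ x n → (x + 1ℚ) ^ n ≡ sumTo n (λ k → ι (n C k) * x ^ k)
[x+1]^n-binomial x n = trans (binomial x 1ℚ n)
  (sumTo-cong n (λ k _ → cong (ι (n C k) *_) (trans (cong (x ^ k *_) (1^p≡1 (n ∸ k))) (*-identityʳ (x ^ k)))))

Δ : ℕ → (ℚ → ℚ) → ℚ
Δ m f = sumTo m (λ k → ι (m C k) * ((- 1ℚ) ^ (m ∸ k) * f (ι k)))

Δ-cong : ∀ m {f g : ℚ → ℚ} → (∀ x → f x ≡ g x) → Δ m f ≡ Δ m g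
Δ-cong m f≗g = sumTo-cong m (λ k _ → cong (λ z → ι (m C k) * ((- 1ℚ) ^ (m ∸ k) * z)) (f≗g (ι k)))

Δ-suc : ∀ m f → Δ (suc m) f ≡ Δ m (λ x → f (x + 1ℚ)) - Δ m f
Δ-suc m f = begin
  Δ (suc m) f
    ≡⟨ sumTo-pascal m g ⟩
  sumTo m (λ k → ι (m C k) * g k) + sumTo m (λ k → ι (m C k) * g (suc k))
    ≡⟨ cong₂ _+_ (trans (sumTo-cong m lower) (sym (*-distribˡ-sumTo m (- 1ℚ) _))) (sumTo-cong m (λ k _ → upper k)) ⟩
  - 1ℚ * Δ m f + Δ m (λ x → f (x + 1ℚ))
    ≡⟨ solve 2 (λ D E → :- con 1ℚ :* D :+ E := E :- D) refl (Δ m f) (Δ m (λ x → f (x + 1ℚ))) ⟩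
  Δ m (λ x → f (x + 1ℚ)) - Δ m f  ∎
  where
  g : ℕ → ℚ
  g k = (- 1ℚ) ^ (suc m ∸ k) * f (ι k)
  lower : ∀ k → k ≤ m → ι (m C k) * g k ≡ - 1ℚ * (ι (m C k) * ((- 1ℚ) ^ (m ∸ k) * f (ι k)))
  lower k k≤m = trans (cong (λ e → ι (m C k) * ((- 1ℚ) ^ e * f (ι k))) (ℕP.+-∸-assoc 1 k≤m))
    (solve 3 (λ C P F → C :* ((:- con 1ℚ :* P) :* F) := :- con 1ℚ :* (C :* (P :* F))) refl
              (ι (m C k)) ((- 1ℚ) ^ (m ∸ k)) (f (ι k)))
  upper : ∀ k → ι (m C k) * g (suc k) ≡ ι (m C k) * ((- 1ℚ) ^ (m ∸ k) * f (ι k + 1ℚ))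
  upper k = cong (λ z → ι (m C k) * ((- 1ℚ) ^ (m ∸ k) * f z)) (trans (ι-suc k) (+-comm 1ℚ (ι k)))

Δ-sumTo : ∀ m n (c : ℕ → ℚ) (f : ℕ → ℚ → ℚ) →
  Δ m (λ x → sumTo n (λ i → c i * f i x)) ≡ sumTo n (λ i → c i * Δ m (f i))
Δ-sumTo m n c f = begin
  Δ m (λ x → sumTo n (λ i → c i * f i x))          ≡⟨ sumTo-cong m (λ k _ → distribute k) ⟩
  sumTo m (λ k → sumTo n (λ i → c i * term i k))   ≡⟨ sumTo-comm m n _ ⟩
  sumTo n (λ i → sumTo m (λ k → c i * term i k))   ≡⟨ sumTo-cong n (λ i _ → *-distribˡ-sumTo m (c i) (term i)) ⟨
  sumTo n (λ i → c i * Δ m (f i))                  ∎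
  where
  term : ℕ → ℕ → ℚ
  term i k = ι (m C k) * ((- 1ℚ) ^ (m ∸ k) * f i (ι k))
  distribute : ∀ k → ι (m C k) * ((- 1ℚ) ^ (m ∸ k) * sumTo n (λ i → c i * f i (ι k))) ≡
                     sumTo n (λ i → c i * term i k)
  distribute k = begin
    ι (m C k) * ((- 1ℚ) ^ (m ∸ k) * sumTo n (λ i → c i * f i (ι k)))
      ≡⟨ cong (ι (m C k) *_) (*-distribˡ-sumTo n ((- 1ℚ) ^ (m ∸ k)) _) ⟩
    ι (m C k) * sumTo n (λ i → (- 1ℚ) ^ (m ∸ k) * (c i * f i (ι k)))
      ≡⟨ *-distribˡ-sumTo n (ι (m C k)) _ ⟩
    sumTo n (λ i → ι (m C k) * ((- 1ℚ) ^ (m ∸ k) * (c i * f i (ι k))))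
      ≡⟨ sumTo-cong n (λ i _ → solve 4 (λ C P D F → C :* (P :* (D :* F)) := D :* (C :* (P :* F))) refl
                                        (ι (m C k)) ((- 1ℚ) ^ (m ∸ k)) (c i) (f i (ι k))) ⟩
    sumTo n (λ i → c i * term i k)                                   ∎

Δ[x^1+j] : ∀ m j → Δ (suc m) (_^ suc j) ≡ sumTo j (λ i → ι (suc j C i) * Δ m (_^ i))
Δ[x^1+j] m j = begin
  Δ (suc m) (_^ suc j)                ≡⟨ Δ-suc m (_^ suc j) ⟩
  Δ m (λ x → (x + 1ℚ) ^ suc j) - D    ≡⟨ cong (_- D) (Δ-cong m (λ x → [x+1]^n-binomial x (suc j))) ⟩
  Δ m (λ x → sumTo (suc j) (λ i → ι (suc j C i) * x ^ i)) - D
    ≡⟨ cong (_- D) (Δ-sumTo m (suc j) (λ i → ι (suc j C i)) (λ i x → x ^ i)) ⟩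
  S + ι (suc j C suc j) * D - D       ≡⟨ cong (λ c → S + ι c * D - D) (nCn≡1 (suc j)) ⟩
  S + 1ℚ * D - D                      ≡⟨ solve 2 (λ S D → S :+ con 1ℚ :* D :- D := S) refl S D ⟩
  S                                   ∎
  where
  D : ℚ
  D = Δ m (_^ suc j)
  S : ℚ
  S = sumTo j (λ i → ι (suc j C i) * Δ m (_^ i))

Δ[x^j]≡0 : ∀ {m j} → j < m → Δ m (_^ j) ≡ 0ℚ
Δ[x^j]≡0 {suc m} {zero}  _         = trans (Δ-suc m (_^ 0)) (+-inverseʳ (Δ m (λ _ → 1ℚ)))
Δ[x^j]≡0 {suc m} {suc j} (s≤s j<m) = trans (Δ[x^1+j] m j) (sumTo-zero j vanish)
  where
  vanish : ∀ i → i ≤ j → ι (suc j C i) * Δ m (_^ i) ≡ 0ℚ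
  vanish i i≤j = trans (cong (ι (suc j C i) *_) (Δ[x^j]≡0 (ℕP.≤-trans (s≤s i≤j) j<m))) (*-zeroʳ (ι (suc j C i)))

Δ[x^m]≡m! : ∀ m → Δ m (_^ m) ≡ ι (m !)
Δ[x^m]≡m! zero    = refl
Δ[x^m]≡m! (suc m) = begin
  Δ (suc m) (_^ suc m)                               ≡⟨ Δ[x^1+j] m m ⟩
  sumTo m (λ i → ι (suc m C i) * Δ m (_^ i))         ≡⟨ sumTo-last m _ vanish ⟩
  ι (suc m C m) * Δ m (_^ m)                         ≡⟨ cong₂ (λ c d → ι c * d) [m+1]Cm≡m+1 (Δ[x^m]≡m! m) ⟩
  ι (suc m) * ι (m !)                                ≡⟨ ι-* (suc m) (m !) ⟨
  ι (suc m !)                                        ∎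
  where
  vanish : ∀ i → i < m → ι (suc m C i) * Δ m (_^ i) ≡ 0ℚ
  vanish i i<m = trans (cong (ι (suc m C i) *_) (Δ[x^j]≡0 i<m)) (*-zeroʳ (ι (suc m C i)))
  [m+1]Cm≡m+1 : suc m C m ≡ suc m
  [m+1]Cm≡m+1 = begin
    suc m C m             ≡⟨ nCk≡nC[n∸k] (ℕP.n≤1+n m) ⟩
    suc m C (suc m ∸ m)   ≡⟨ cong (suc m C_) (ℕP.m+n∸n≡m 1 m) ⟩
    suc m C 1             ≡⟨ nC1≡n (suc m) ⟩
    suc m                 ∎

[-a]^p≡[-1]^p*a^p : ∀ a p → (- a) ^ p ≡ (- 1ℚ) ^ p * a ^ p
[-a]^p≡[-1]^p*a^p a p =
  trans (cong (_^ p) (solve 1 (λ A → :- A := :- con 1ℚ :* A) refl a)) (^-distrib-* (- 1ℚ) a p)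

abelSum : ℕ → ℚ → ℚ → ℚ
abelSum n w s = sumTo n (λ k → ι (n C k) * (ι k * w) ^ k * (s - ι k * w) ^ (n ∸ k))

fallingTerm : ℕ → ℚ → ℚ → ℕ → ℚ
fallingTerm n w s m = ι (n P′ m) * w ^ m * s ^ (n ∸ m)

abel : ∀ n w s → abelSum n w s ≡ sumTo n (fallingTerm n w s)
abel n w s = begin
  abelSum n w s                                      ≡⟨ sumTo-cong n (λ k _ → expand k) ⟩
  sumTo n (λ k → sumTo (n ∸ k) (term k))             ≡⟨ sumTo-triangle n term ⟩
  sumTo n (λ m → sumTo m (λ k → term k (m ∸ k)))     ≡⟨ sumTo-cong n collect ⟩
  sumTo n (fallingTerm n w s)                        ∎
  where
  term : ℕ → ℕ → ℚ
  term k j = ι (n C k) * ι ((n ∸ k) C j) * (ι k * w) ^ k * (- (ι k * w)) ^ j * s ^ (n ∸ k ∸ j)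

  expand : ∀ k → ι (n C k) * (ι k * w) ^ k * (s - ι k * w) ^ (n ∸ k) ≡ sumTo (n ∸ k) (term k)
  expand k = begin
    c * (s - a) ^ (n ∸ k)     ≡⟨ cong (λ b → c * b ^ (n ∸ k)) (+-comm s (- a)) ⟩
    c * (- a + s) ^ (n ∸ k)   ≡⟨ cong (c *_) (binomial (- a) s (n ∸ k)) ⟩
    c * sumTo (n ∸ k) (λ j → ι ((n ∸ k) C j) * ((- a) ^ j * s ^ (n ∸ k ∸ j)))
      ≡⟨ *-distribˡ-sumTo (n ∸ k) c _ ⟩
    sumTo (n ∸ k) (λ j → c * (ι ((n ∸ k) C j) * ((- a) ^ j * s ^ (n ∸ k ∸ j))))
      ≡⟨ sumTo-cong (n ∸ k) (λ j _ → solve 5 (λ B P D Q S → (B :* P) :* (D :* (Q :* S)) := B :* D :* P :* Q :* S) refl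
                                          (ι (n C k)) (a ^ k) (ι ((n ∸ k) C j)) ((- a) ^ j) (s ^ (n ∸ k ∸ j))) ⟩
    sumTo (n ∸ k) (term k)    ∎
    where
    a : ℚ
    a = ι k * w
    c : ℚ
    c = ι (n C k) * a ^ k

  regroup : ∀ {k m} → k ≤ m → m ≤ n →
    term k (m ∸ k) ≡ ι (n C m) * w ^ m * s ^ (n ∸ m) * (ι (m C k) * ((- 1ℚ) ^ (m ∸ k) * ι k ^ m))
  regroup {k} {m} k≤m m≤n = begin
    ι (n C k) * ι ((n ∸ k) C (m ∸ k)) * a ^ k * (- a) ^ (m ∸ k) * s ^ (n ∸ k ∸ (m ∸ k))
      ≡⟨ cong₂ (λ b e → ι (n C k) * ι ((n ∸ k) C (m ∸ k)) * a ^ k * b * s ^ e)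
               ([-a]^p≡[-1]^p*a^p a (m ∸ k)) n∸k∸[m∸k]≡n∸m ⟩
    ι (n C k) * ι ((n ∸ k) C (m ∸ k)) * a ^ k * ((- 1ℚ) ^ (m ∸ k) * a ^ (m ∸ k)) * s ^ (n ∸ m)
      ≡⟨ solve 6 (λ B D P N Q S → B :* D :* P :* (N :* Q) :* S := (B :* D) :* (N :* (P :* Q)) :* S) refl
           (ι (n C k)) (ι ((n ∸ k) C (m ∸ k))) (a ^ k) ((- 1ℚ) ^ (m ∸ k)) (a ^ (m ∸ k)) (s ^ (n ∸ m)) ⟩
    (ι (n C k) * ι ((n ∸ k) C (m ∸ k))) * ((- 1ℚ) ^ (m ∸ k) * (a ^ k * a ^ (m ∸ k))) * s ^ (n ∸ m)
      ≡⟨ cong₂ (λ b p → b * ((- 1ℚ) ^ (m ∸ k) * p) * s ^ (n ∸ m)) binomials powers ⟩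
    (ι (n C m) * ι (m C k)) * ((- 1ℚ) ^ (m ∸ k) * (ι k ^ m * w ^ m)) * s ^ (n ∸ m)
      ≡⟨ solve 6 (λ B D N K W S → (B :* D) :* (N :* (K :* W)) :* S := B :* W :* S :* (D :* (N :* K))) refl
           (ι (n C m)) (ι (m C k)) ((- 1ℚ) ^ (m ∸ k)) (ι k ^ m) (w ^ m) (s ^ (n ∸ m)) ⟩
    ι (n C m) * w ^ m * s ^ (n ∸ m) * (ι (m C k) * ((- 1ℚ) ^ (m ∸ k) * ι k ^ m))  ∎
    where
    a : ℚ
    a = ι k * w
    n∸k∸[m∸k]≡n∸m : n ∸ k ∸ (m ∸ k) ≡ n ∸ m
    n∸k∸[m∸k]≡n∸m = trans (ℕP.∸-+-assoc n k (m ∸ k)) (cong (n ∸_) (ℕP.m+[n∸m]≡n k≤m))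
    binomials : ι (n C k) * ι ((n ∸ k) C (m ∸ k)) ≡ ι (n C m) * ι (m C k)
    binomials = trans (sym (ι-* (n C k) ((n ∸ k) C (m ∸ k))))
                      (trans (cong ι (nCk*[n∸k]C[m∸k]≡nCm*mCk k≤m m≤n)) (ι-* (n C m) (m C k)))
    powers : a ^ k * a ^ (m ∸ k) ≡ ι k ^ m * w ^ m
    powers = begin
      a ^ k * a ^ (m ∸ k)   ≡⟨ ^-homo-* a k (m ∸ k) ⟨
      a ^ (k ℕ.+ (m ∸ k))   ≡⟨ cong (a ^_) (ℕP.m+[n∸m]≡n k≤m) ⟩
      a ^ m                 ≡⟨ ^-distrib-* (ι k) w m ⟩
      ι k ^ m * w ^ m       ∎

  collect : ∀ m → m ≤ n → sumTo m (λ k → term k (m ∸ k)) ≡ fallingTerm n w s m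
  collect m m≤n = begin
    sumTo m (λ k → term k (m ∸ k))                                    ≡⟨ sumTo-cong m (λ k k≤m → regroup k≤m m≤n) ⟩
    sumTo m (λ k → c * (ι (m C k) * ((- 1ℚ) ^ (m ∸ k) * ι k ^ m)))    ≡⟨ *-distribˡ-sumTo m c _ ⟨
    c * Δ m (_^ m)                                                    ≡⟨ cong (c *_) (Δ[x^m]≡m! m) ⟩
    c * ι (m !)
      ≡⟨ solve 4 (λ B W S F → B :* W :* S :* F := B :* F :* W :* S) refl (ι (n C m)) (w ^ m) (s ^ (n ∸ m)) (ι (m !)) ⟩
    ι (n C m) * ι (m !) * w ^ m * s ^ (n ∸ m)
      ≡⟨ cong (λ b → b * w ^ m * s ^ (n ∸ m)) (trans (sym (ι-* (n C m) (m !))) (cong ι (nCk*k!≡nP′k m≤n))) ⟩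
    fallingTerm n w s m                                               ∎
    where
    c : ℚ
    c = ι (n C m) * w ^ m * s ^ (n ∸ m)

fallingTerm-+ : ∀ n w s m r → ι (n P′ m) * w ^ m * fallingTerm (n ∸ m) w s r ≡ fallingTerm n w s (m ℕ.+ r)
fallingTerm-+ n w s m r = begin
  ι (n P′ m) * w ^ m * (ι ((n ∸ m) P′ r) * w ^ r * s ^ (n ∸ m ∸ r))
    ≡⟨ solve 5 (λ P W Q V S → P :* W :* (Q :* V :* S) := P :* Q :* (W :* V) :* S) refl
                (ι (n P′ m)) (w ^ m) (ι ((n ∸ m) P′ r)) (w ^ r) (s ^ (n ∸ m ∸ r)) ⟩
  ι (n P′ m) * ι ((n ∸ m) P′ r) * (w ^ m * w ^ r) * s ^ (n ∸ m ∸ r)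
    ≡⟨ cong (λ p → p * (w ^ m * w ^ r) * s ^ (n ∸ m ∸ r)) falling ⟩
  ι (n P′ (m ℕ.+ r)) * (w ^ m * w ^ r) * s ^ (n ∸ m ∸ r)
    ≡⟨ cong₂ (λ p e → ι (n P′ (m ℕ.+ r)) * p * s ^ e) (sym (^-homo-* w m r)) (ℕP.∸-+-assoc n m r) ⟩
  fallingTerm n w s (m ℕ.+ r)  ∎
  where
  falling : ι (n P′ m) * ι ((n ∸ m) P′ r) ≡ ι (n P′ (m ℕ.+ r))
  falling = trans (sym (ι-* (n P′ m) ((n ∸ m) P′ r))) (cong ι (sym (nP′[m+r]≡nP′m*[n∸m]P′r n m r)))

abel-iterated : ∀ n w s →
  sumTo n (λ k → ι (n C k) * (ι k * w) ^ k * abelSum (n ∸ k) w (s - ι k * w)) ≡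
  sumTo n (λ t → ι (suc t) * fallingTerm n w s t)
abel-iterated n w s = begin
  sumTo n (λ k → c k * abelSum (n ∸ k) w (s - ι k * w))
    ≡⟨ sumTo-cong n (λ k _ → trans (cong (c k *_) (abel (n ∸ k) w (s - ι k * w))) (*-distribˡ-sumTo (n ∸ k) (c k) _)) ⟩
  sumTo n (λ k → sumTo (n ∸ k) (λ m → c k * fallingTerm (n ∸ k) w (s - ι k * w) m))
    ≡⟨ sumTo-triangle-comm n (λ k m → c k * fallingTerm (n ∸ k) w (s - ι k * w) m) ⟩
  sumTo n (λ m → sumTo (n ∸ m) (λ k → c k * fallingTerm (n ∸ k) w (s - ι k * w) m))
    ≡⟨ sumTo-cong n inner-sum ⟩
  sumTo n (λ m → sumTo (n ∸ m) (λ r → fallingTerm n w s (m ℕ.+ r)))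
    ≡⟨ sumTo-triangle n (λ m r → fallingTerm n w s (m ℕ.+ r)) ⟩
  sumTo n (λ t → sumTo t (λ m → fallingTerm n w s (m ℕ.+ (t ∸ m))))
    ≡⟨ sumTo-cong n (λ t _ → trans (sumTo-cong t (λ m m≤t → cong (fallingTerm n w s) (ℕP.m+[n∸m]≡n m≤t)))
                                   (sumTo-const t _)) ⟩
  sumTo n (λ t → ι (suc t) * fallingTerm n w s t)  ∎
  where
  c : ℕ → ℚ
  c k = ι (n C k) * (ι k * w) ^ k

  exchange : ∀ {k m} → m ≤ n → k ≤ n ∸ m →
    c k * fallingTerm (n ∸ k) w (s - ι k * w) m ≡
    ι (n P′ m) * w ^ m * (ι ((n ∸ m) C k) * (ι k * w) ^ k * (s - ι k * w) ^ (n ∸ m ∸ k))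
  exchange {k} {m} m≤n k≤n∸m = begin
    ι (n C k) * a ^ k * (ι ((n ∸ k) P′ m) * w ^ m * b ^ (n ∸ k ∸ m))
      ≡⟨ solve 5 (λ C A P W B → C :* A :* (P :* W :* B) := C :* P :* (W :* A :* B)) refl
                  (ι (n C k)) (a ^ k) (ι ((n ∸ k) P′ m)) (w ^ m) (b ^ (n ∸ k ∸ m)) ⟩
    ι (n C k) * ι ((n ∸ k) P′ m) * (w ^ m * a ^ k * b ^ (n ∸ k ∸ m))
      ≡⟨ cong₂ (λ p e → p * (w ^ m * a ^ k * b ^ e)) coefficients n∸k∸m≡n∸m∸k ⟩
    ι (n P′ m) * ι ((n ∸ m) C k) * (w ^ m * a ^ k * b ^ (n ∸ m ∸ k))
      ≡⟨ solve 5 (λ P C W A B → P :* C :* (W :* A :* B) := P :* W :* (C :* A :* B)) refl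
                  (ι (n P′ m)) (ι ((n ∸ m) C k)) (w ^ m) (a ^ k) (b ^ (n ∸ m ∸ k)) ⟩
    ι (n P′ m) * w ^ m * (ι ((n ∸ m) C k) * a ^ k * b ^ (n ∸ m ∸ k))  ∎
    where
    a : ℚ
    a = ι k * w
    b : ℚ
    b = s - ι k * w
    coefficients : ι (n C k) * ι ((n ∸ k) P′ m) ≡ ι (n P′ m) * ι ((n ∸ m) C k)
    coefficients = begin
      ι (n C k) * ι ((n ∸ k) P′ m)      ≡⟨ ι-* (n C k) ((n ∸ k) P′ m) ⟨
      ι ((n C k) ℕ.* ((n ∸ k) P′ m))
        ≡⟨ cong ι (nCk*[n∸k]P′m≡nP′m*[n∸m]Ck {n} {k} {m} (ℕP.m≤o∸n⇒m+n≤o k m≤n k≤n∸m)) ⟩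
      ι ((n P′ m) ℕ.* ((n ∸ m) C k))    ≡⟨ ι-* (n P′ m) ((n ∸ m) C k) ⟩
      ι (n P′ m) * ι ((n ∸ m) C k)      ∎
    n∸k∸m≡n∸m∸k : n ∸ k ∸ m ≡ n ∸ m ∸ k
    n∸k∸m≡n∸m∸k = trans (ℕP.∸-+-assoc n k m) (trans (cong (n ∸_) (ℕP.+-comm k m)) (sym (ℕP.∸-+-assoc n m k)))

  inner-sum : ∀ m → m ≤ n →
    sumTo (n ∸ m) (λ k → c k * fallingTerm (n ∸ k) w (s - ι k * w) m) ≡
    sumTo (n ∸ m) (λ r → fallingTerm n w s (m ℕ.+ r))
  inner-sum m m≤n = begin
    sumTo (n ∸ m) (λ k → c k * fallingTerm (n ∸ k) w (s - ι k * w) m)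
      ≡⟨ sumTo-cong (n ∸ m) (λ k k≤n∸m → exchange m≤n k≤n∸m) ⟩
    sumTo (n ∸ m) (λ k → d * (ι ((n ∸ m) C k) * (ι k * w) ^ k * (s - ι k * w) ^ (n ∸ m ∸ k)))
      ≡⟨ *-distribˡ-sumTo (n ∸ m) d _ ⟨
    d * abelSum (n ∸ m) w s                               ≡⟨ cong (d *_) (abel (n ∸ m) w s) ⟩
    d * sumTo (n ∸ m) (fallingTerm (n ∸ m) w s)           ≡⟨ *-distribˡ-sumTo (n ∸ m) d _ ⟩
    sumTo (n ∸ m) (λ r → d * fallingTerm (n ∸ m) w s r)   ≡⟨ sumTo-cong (n ∸ m) (λ r _ → fallingTerm-+ n w s m r) ⟩
    sumTo (n ∸ m) (λ r → fallingTerm n w s (m ℕ.+ r))     ∎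
    where
    d : ℚ
    d = ι (n P′ m) * w ^ m

sumTo-falling-moment : ∀ n w → ι n * w ≡ 1ℚ → sumTo n (λ t → ι t * fallingTerm n w 1ℚ t) ≡ ι n
sumTo-falling-moment n w nw≡1 = begin
  sumTo n (λ t → ι t * fallingTerm n w 1ℚ t)    ≡⟨ sumTo-cong n step ⟩
  sumTo n (λ t → ι n * (v t - v (suc t)))       ≡⟨ *-distribˡ-sumTo n (ι n) _ ⟨
  ι n * sumTo n (λ t → v t - v (suc t))         ≡⟨ cong (ι n *_) (sumTo-telescope n v) ⟩
  ι n * (v 0 - v (suc n))                       ≡⟨ cong (λ z → ι n * (v 0 - z)) v[n+1]≡0 ⟩
  ι n * (1ℚ - 0ℚ)                               ≡⟨ solve 1 (λ N → N :* (con 1ℚ :- con 0ℚ) := N) refl (ι n) ⟩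
  ι n                                           ∎
  where
  v : ℕ → ℚ
  v t = ι (n P′ t) * w ^ t

  v[n+1]≡0 : v (suc n) ≡ 0ℚ
  v[n+1]≡0 = trans (cong (λ e → ι (e ℕ.* (n P′ n)) * w ^ suc n) (ℕP.n∸n≡0 n)) (*-zeroˡ (w ^ suc n))

  v[t+1] : ∀ {t} → t ≤ n → v (suc t) ≡ v t - ι t * w * v t
  v[t+1] {t} t≤n = begin
    ι ((n ∸ t) ℕ.* (n P′ t)) * (w * w ^ t)
      ≡⟨ cong (_* (w * w ^ t)) (trans (ι-* (n ∸ t) (n P′ t)) (cong (_* ι (n P′ t)) (ι-∸ t≤n))) ⟩
    (ι n - ι t) * ι (n P′ t) * (w * w ^ t)
      ≡⟨ solve 5 (λ N T P W X → (N :- T) :* P :* (W :* X) := N :* W :* (P :* X) :- T :* W :* (P :* X)) refl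
                  (ι n) (ι t) (ι (n P′ t)) w (w ^ t) ⟩
    ι n * w * v t - ι t * w * v t     ≡⟨ cong (λ e → e * v t - ι t * w * v t) nw≡1 ⟩
    1ℚ * v t - ι t * w * v t          ≡⟨ cong (_- ι t * w * v t) (*-identityˡ (v t)) ⟩
    v t - ι t * w * v t               ∎

  step : ∀ t → t ≤ n → ι t * fallingTerm n w 1ℚ t ≡ ι n * (v t - v (suc t))
  step t t≤n = begin
    ι t * (v t * 1ℚ ^ (n ∸ t))             ≡⟨ cong (λ z → ι t * (v t * z)) (1^p≡1 (n ∸ t)) ⟩
    ι t * (v t * 1ℚ)
      ≡⟨ solve 2 (λ T V → T :* (V :* con 1ℚ) := con 1ℚ :* (T :* V)) refl (ι t) (v t) ⟩
    1ℚ * (ι t * v t)                       ≡⟨ cong (_* (ι t * v t)) nw≡1 ⟨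
    ι n * w * (ι t * v t)
      ≡⟨ solve 4 (λ N W T V → N :* W :* (T :* V) := N :* (V :- (V :- T :* W :* V))) refl (ι n) w (ι t) (v t) ⟩
    ι n * (v t - (v t - ι t * w * v t))    ≡⟨ cong (λ z → ι n * (v t - z)) (v[t+1] t≤n) ⟨
    ι n * (v t - v (suc t))                ∎

sumTo-ι[1+k]*f : ∀ n (f : ℕ → ℚ) → sumTo n (λ k → ι (suc k) * f k) ≡ sumTo n f + sumTo n (λ k → ι k * f k)
sumTo-ι[1+k]*f n f = trans (sumTo-cong n split) (sumTo-distrib-+ n f (λ k → ι k * f k))
  where
  split : ∀ k → k ≤ n → ι (suc k) * f k ≡ f k + ι k * f k
  split k _ = trans (cong (_* f k) (ι-suc k)) (solve 2 (λ K F → (con 1ℚ :+ K) :* F := F :+ K :* F) refl (ι k) (f k))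

module _ (n : ℕ) .{{_ : NonZero n}} where

  private
    w : ℚ
    w = (+ 1) / n

  ξ≡abelSum : ξ n ≡ abelSum n w 1ℚ
  ξ≡abelSum = sumTo-cong n (λ k _ → cong (λ q → ι (n C k) * q ^ k * (1ℚ - q) ^ (n ∸ k)) (k/n≡ι[k]*1/n k n))

  ξ₂≡sumTo-abelSum : ξ₂ n ≡ sumTo n (λ k → ι (n C k) * (ι k * w) ^ k * abelSum (n ∸ k) w (1ℚ - ι k * w))
  ξ₂≡sumTo-abelSum = sumTo-cong n (λ k _ →
    trans (sumTo-cong (n ∸ k) (λ j _ → regroup k j)) (sym (*-distribˡ-sumTo (n ∸ k) (ι (n C k) * (ι k * w) ^ k) _)))
    where
    regroup : ∀ k j →
      ι (n C k) * ι ((n ∸ k) C j) * ((+ k) / n) ^ k * ((+ j) / n) ^ j * (1ℚ - (+ k) / n - (+ j) / n) ^ (n ∸ k ∸ j) ≡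
      ι (n C k) * (ι k * w) ^ k * (ι ((n ∸ k) C j) * (ι j * w) ^ j * (1ℚ - ι k * w - ι j * w) ^ (n ∸ k ∸ j))
    regroup k j = trans
      (cong₂ (λ p q → ι (n C k) * ι ((n ∸ k) C j) * p ^ k * q ^ j * (1ℚ - p - q) ^ (n ∸ k ∸ j))
             (k/n≡ι[k]*1/n k n) (k/n≡ι[k]*1/n j n))
      (solve 5 (λ B D P Q R → B :* D :* P :* Q :* R := B :* P :* (D :* Q :* R)) refl
               (ι (n C k)) (ι ((n ∸ k) C j)) ((ι k * w) ^ k) ((ι j * w) ^ j) ((1ℚ - ι k * w - ι j * w) ^ (n ∸ k ∸ j)))

mainTheorem1 : (n : ℕ) → .{{_ : NonZero n}} → ξ₂ n ≡ ξ n + ι n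
mainTheorem1 n = begin
  ξ₂ n
    ≡⟨ ξ₂≡sumTo-abelSum n ⟩
  sumTo n (λ k → ι (n C k) * (ι k * w) ^ k * abelSum (n ∸ k) w (1ℚ - ι k * w))
    ≡⟨ abel-iterated n w 1ℚ ⟩
  sumTo n (λ t → ι (suc t) * fallingTerm n w 1ℚ t)
    ≡⟨ sumTo-ι[1+k]*f n (fallingTerm n w 1ℚ) ⟩
  sumTo n (fallingTerm n w 1ℚ) + sumTo n (λ t → ι t * fallingTerm n w 1ℚ t)
    ≡⟨ cong₂ _+_ (sym (abel n w 1ℚ)) (sumTo-falling-moment n w (ι[n]*1/n≡1 n)) ⟩
  abelSum n w 1ℚ + ι n
    ≡⟨ cong (_+ ι n) (ξ≡abelSum n) ⟨
  ξ n + ι n  ∎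
  where
  w : ℚ
  w = (+ 1) / n
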